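{- Let $\mathcal{M}=(X,\vec{\mathcal{C}},\mathcal{V})$ be a quasi-discrete closure model. For all $x_1,x_2\in X$: $x_1$ and $x_2$ are CMC-bisimilar in $\mathcal{M}$ if and only if they satisfy exactly the same ${\tt IMLC}$ formulas in $\mathcal{M}$.
   Context: Fix a set $\mathtt{AP}$ of atomic propositions. For a relation $R\subseteq X\times X$ let $\mathcal{C}_R(A)=A\cup\{x\in X:\exists a\in A,\ (a,x)\in R\}$. A quasi-discrete closure model is $\mathcal{M}=(X,\vec{\mathcal{C}},\mathcal{V})$ with $\vec{\mathcal{C}}=\mathcal{C}_R$ for a relation $R\subseteq X\times X$ and $\mathcal{V}:\mathtt{AP}\to\mathcal{P}(X)$; put $\overleftarrow{\mathcal{C}}=\mathcal{C}_{R^{ -1}}$ and write $\vec{\mathcal{C}}(x)$ for $\vec{\mathcal{C}}(\{x\})$, similarly for $\overleftarrow{\mathcal{C}}$. A symmetric relation $B\subseteq X\times X$ is a CMC-bisimulation if whenever $(x_1,x_2)\in B$: (1) for all $p\in\mathtt{AP}$, $x_1\in\mathcal{V}(p)$ iff $x_2\in\mathcal{V}(p)$; (2) for all $x_1'\in\vec{\mathcal{C}}(x_1)$ there is $x_2'\in\vec{\mathcal{C}}(x_2)$ with $(x_1',x_2')\in B$; (3) for all $x_1'\in\overleftarrow{\mathcal{C}}(x_1)$ there is $x_2'\in\overleftarrow{\mathcal{C}}(x_2)$ with $(x_1',x_2')\in B$. Points are CMC-bisimilar if some CMC-bisimulation contains the pair. ${\tt IMLC}$ formulas: $\Phi::=p\mid\neg\Phi\mid\bigwedge_{i\in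 I}\Phi_i\mid\vec{\mathcal{N}}\Phi\mid\overleftarrow{\mathcal{N}}\Phi$ ($I$ arbitrary index set), with $x\models p$ iff $x\in\mathcal{V}(p)$, usual Boolean clauses, $x\models\vec{\mathcal{N}}\Phi$ iff $x\in\vec{\mathcal{C}}(\{y:y\models\Phi\})$, and $x\models\overleftarrow{\mathcal{N}}\Phi$ iff $x\in\overleftarrow{\mathcal{C}}(\{y:y\models\Phi\})$. -}

module Defs where

open import Level using (0ℓ) renaming (suc to lsuc)
open import Data.Product using (Σ; ∃; _×_; _,_)
open import Data.Sum using (_⊎_)
open import Relation.Binary.PropositionalEquality using (_≡_)
open import Relation.Nullary using (¬_)
open import Function.Bundles using (_⇔_)

Pred : Set → Set₁
Pred X = X → Set

Clo : {X : Set} → (X → X → Set) → Pred X → Pred X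
Clo {X} R A x = A x ⊎ Σ X (λ a → A a × R a x)

_⁻¹ : {X : Set} → (X → X → Set) → (X → X → Set)
(R ⁻¹) x y = R y x

｛_｝ : {X : Set} → X → Pred X
｛ x ｝ y = x ≡ y

record QDCM (AP : Set) : Set₁ where
  field
    X : Set
    R : X → X → Set
    V : AP → Pred X

  Cf : Pred X → Pred X
  Cf = Clo R
  Cb : Pred X → Pred X
  Cb = Clo (R ⁻¹)

data IMLC (AP : Set) : Set₁ where
  atom : AP → IMLC AP
  neg  : IMLC AP → IMLC AP
  conj : (I : Set) → (I → IMLC AP) → IMLC AP
  Nf   : IMLC AP → IMLC AP
  Nb   : IMLC AP → IMLC AP

module _ {AP : Set} (M : QDCM AP) where
  open QDCM M

  Sat : X → IMLC AP → Set
  Sat x (atom p)   = V p x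
  Sat x (neg Φ)    = ¬ Sat x Φ
  Sat x (conj I Φ) = (i : I) → Sat x (Φ i)
  Sat x (Nf Φ)     = Cf (λ y → Sat y Φ) x
  Sat x (Nb Φ)     = Cb (λ y → Sat y Φ) x

  Symmetric : (X → X → Set) → Set
  Symmetric B = ∀ {x y} → B x y → B y x

  IsCMCBisim : (X → X → Set) → Set
  IsCMCBisim B =
    Symmetric B ×
    (∀ {x₁ x₂} → B x₁ x₂ →
      ((p : AP) → V p x₁ ⇔ V p x₂) ×
      ((x₁' : X) → Cf ｛ x₁ ｝ x₁' → Σ X (λ x₂' → Cf ｛ x₂ ｝ x₂' × B x₁' x₂')) ×
      ((x₁' : X) → Cb ｛ x₁ ｝ x₁' → Σ X (λ x₂' → Cb ｛ x₂ ｝ x₂' × B x₁' x₂')))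

  CMCBisimilar : X → X → Set₁
  CMCBisimilar x₁ x₂ = Σ (X → X → Set) (λ B → IsCMCBisim B × B x₁ x₂)

  IMLCEquiv : X → X → Set₁
  IMLCEquiv x₁ x₂ = (Φ : IMLC AP) → Sat x₁ Φ ⇔ Sat x₂ Φ

-- Soundness is induction on formulas: x ∈ C_R(A) iff C_{R⁻¹}(x) meets A, and the zig
-- condition for the converse closure is exactly what transports such a meeting point.
-- Completeness is classical: IMLC-equivalence is itself a CMC-bisimulation.  The conjunction
-- χ y of formulas separating y from each inequivalent point holds only at points equivalent
-- to y, so the zig condition for C→ (resp. C←) at x₁ ≈ x₂ follows by transferring ←N (χ x₁')
-- (resp. →N (χ x₁')) from x₁ to x₂.
module Submission where

open import Defs
open import Level using (0ℓ; suc)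
open import Axiom.ExcludedMiddle using (ExcludedMiddle)
open import Data.Product using (Σ; _×_; _,_; proj₁; proj₂)
open import Data.Sum using (inj₁; inj₂)
open import Function.Bundles using (_⇔_; mk⇔; Equivalence)
open import Function.Construct.Symmetry using (⇔-sym)
open import Relation.Nullary using (¬_)
open import Relation.Nullary.Decidable using (True; toWitness; fromWitness; decidable-stable)
open import Relation.Binary.PropositionalEquality using (refl)

open Equivalence using (to; from)

module _ {X : Set} (R : X → X → Set) where

  Clo⇔converse-closure-meets : {A : Pred X} {x : X} →
    Clo R A x ⇔ Σ X (λ a → A a × Clo (R ⁻¹) ｛ x ｝ a)
  Clo⇔converse-closure-meets {A} {x} = mk⇔ meets closed
    where
    meets : Clo R A x → Σ X (λ a → A a × Clo (R ⁻¹) ｛ x ｝ a)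
    meets (inj₁ Ax)            = x , Ax , inj₁ refl
    meets (inj₂ (a , Aa , Rax)) = a , Aa , inj₂ (x , refl , Rax)

    closed : Σ X (λ a → A a × Clo (R ⁻¹) ｛ x ｝ a) → Clo R A x
    closed (.x , Ax , inj₁ refl)             = inj₁ Ax
    closed (a , Aa , inj₂ (.x , refl , Rax)) = inj₂ (a , Aa , Rax)

  ConverseZig : (X → X → Set) → Set
  ConverseZig B = ∀ {x₁ x₂} → B x₁ x₂ →
    (x₁' : X) → Clo (R ⁻¹) ｛ x₁ ｝ x₁' → Σ X (λ x₂' → Clo (R ⁻¹) ｛ x₂ ｝ x₂' × B x₁' x₂')

  Clo-transfer : {B : X → X → Set} {A A' : Pred X} → ConverseZig B →
    (∀ {a a'} → B a a' → A a → A' a') →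
    ∀ {x y} → B x y → Clo R A x → Clo R A' y
  Clo-transfer zig A⇒A' Bxy Ax
    with a , Aa , xa ← to Clo⇔converse-closure-meets Ax
    with a' , ya' , Baa' ← zig Bxy a xa
    = from Clo⇔converse-closure-meets (a' , A⇒A' Baa' Aa , ya')

  converse-zig-by-characteristic : {E : X → X → Set} {χ : X → Pred X} →
    (∀ y → χ y y) → (∀ {y z} → χ y z → E y z) →
    ∀ {x₁ x₂} → (∀ {y} → Clo R (χ y) x₁ → Clo R (χ y) x₂) →
    (x₁' : X) → Clo (R ⁻¹) ｛ x₁ ｝ x₁' → Σ X (λ x₂' → Clo (R ⁻¹) ｛ x₂ ｝ x₂' × E x₁' x₂')
  converse-zig-by-characteristic χ-self χ⇒E transfer x₁' x₁x₁'
    with x₂' , χx₂' , x₂x₂' ←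
         to Clo⇔converse-closure-meets (transfer (from Clo⇔converse-closure-meets (x₁' , χ-self x₁' , x₁x₁')))
    = x₂' , x₂x₂' , χ⇒E χx₂'

module Soundness {AP : Set} (M : QDCM AP) where
  open QDCM M

  Sat-transfer : {B : X → X → Set} → IsCMCBisim M B →
    (Φ : IMLC AP) → ∀ {x y} → B x y → Sat M x Φ → Sat M y Φ
  Sat-transfer bisim (atom p)   Bxy xΦ = to (proj₁ (proj₂ bisim Bxy) p) xΦ
  Sat-transfer bisim (neg Φ)    Bxy x¬Φ yΦ = x¬Φ (Sat-transfer bisim Φ (proj₁ bisim Bxy) yΦ)
  Sat-transfer bisim (conj I Φ) Bxy xΦ i = Sat-transfer bisim (Φ i) Bxy (xΦ i)
  Sat-transfer bisim (Nf Φ)     Bxy xΦ =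
    Clo-transfer R (λ Buv → proj₂ (proj₂ (proj₂ bisim Buv))) (Sat-transfer bisim Φ) Bxy xΦ
  Sat-transfer bisim (Nb Φ)     Bxy xΦ =
    Clo-transfer (R ⁻¹) (λ Buv → proj₁ (proj₂ (proj₂ bisim Buv))) (Sat-transfer bisim Φ) Bxy xΦ

  CMCBisimilar⇒IMLCEquiv : ∀ {x₁ x₂} → CMCBisimilar M x₁ x₂ → IMLCEquiv M x₁ x₂
  CMCBisimilar⇒IMLCEquiv (B , bisim , B₁₂) Φ =
    mk⇔ (Sat-transfer bisim Φ B₁₂) (Sat-transfer bisim Φ (proj₁ bisim B₁₂))

module Completeness (em₀ : ExcludedMiddle 0ℓ) (em₁ : ExcludedMiddle (suc 0ℓ))
                    {AP : Set} (M : QDCM AP) where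
  open QDCM M

  -- IMLCEquiv lives in Set₁ (formulas quantify over index sets); excluded middle resizes it.
  Equivalent : X → X → Set
  Equivalent x y = True (em₁ {IMLCEquiv M x y})

  Equivalent-sym : ∀ {x y} → Equivalent x y → Equivalent y x
  Equivalent-sym xy = fromWitness (λ Φ → ⇔-sym (toWitness xy Φ))

  separating-formula : ∀ {x z} → ¬ Equivalent x z →
    Σ (IMLC AP) (λ Φ → Sat M x Φ × ¬ Sat M z Φ)
  separating-formula {x} {z} x≁z = decidable-stable em₁ λ inseparable →
    x≁z (fromWitness λ Φ →
      mk⇔ (preserved inseparable Φ)
          (λ zΦ → decidable-stable em₀ λ x¬Φ → inseparable (neg Φ , x¬Φ , λ z¬Φ → z¬Φ zΦ)))
    where
    preserved : ¬ Σ (IMLC AP) (λ Φ → Sat M x Φ × ¬ Sat M z Φ) → ∀ Φ → Sat M x Φ → Sat M z Φ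
    preserved inseparable Φ xΦ = decidable-stable em₀ λ z¬Φ → inseparable (Φ , xΦ , z¬Φ)

  characteristic : X → IMLC AP
  characteristic x =
    conj (Σ X (λ z → ¬ Equivalent x z)) (λ (_ , x≁z) → proj₁ (separating-formula x≁z))

  Sat-characteristic : ∀ x → Sat M x (characteristic x)
  Sat-characteristic x (_ , x≁z) = proj₁ (proj₂ (separating-formula x≁z))

  Sat-characteristic⇒Equivalent : ∀ {x z} → Sat M z (characteristic x) → Equivalent x z
  Sat-characteristic⇒Equivalent {x} {z} zχ =
    decidable-stable em₀ λ x≁z → proj₂ (proj₂ (separating-formula x≁z)) (zχ (z , x≁z))

  Equivalent-isCMCBisim : IsCMCBisim M Equivalent
  Equivalent-isCMCBisim = Equivalent-sym , λ x₁≈x₂ →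
    (λ p → toWitness x₁≈x₂ (atom p)) ,
    converse-zig-by-characteristic (R ⁻¹) Sat-characteristic Sat-characteristic⇒Equivalent
      (λ {y} → to (toWitness x₁≈x₂ (Nb (characteristic y)))) ,
    converse-zig-by-characteristic R Sat-characteristic Sat-characteristic⇒Equivalent
      (λ {y} → to (toWitness x₁≈x₂ (Nf (characteristic y))))

theorem4p13 : ExcludedMiddle 0ℓ → ExcludedMiddle (suc 0ℓ) → {AP : Set} (M : QDCM AP) (x₁ x₂ : QDCM.X M) →
    CMCBisimilar M x₁ x₂ ⇔ IMLCEquiv M x₁ x₂
theorem4p13 em₀ em₁ M x₁ x₂ =
  mk⇔ (Soundness.CMCBisimilar⇒IMLCEquiv M)
      (λ x₁≡x₂ → Equivalent , Equivalent-isCMCBisim , fromWitness x₁≡x₂)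
  where open Completeness em₀ em₁ M
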